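{- Let $p \geq 5$ be prime and $A \subseteq \mathbb{Z}_p^2$ with $|A| = 2p+1$. Let $H$ be a subgroup of $\mathbb{Z}_p^2$ of order $p$, with cosets indexed $H_0 = H, H_1, \dots, H_{p-1}$ so that $H_i + H_j = H_{i+j}$ (indices mod $p$), and put $A_i = A \cap H_i$. Assume $|A_0| \geq |A_i|$ for all $i$, and that $|A_0| \geq \frac{p+3}{2}$. Let $\ell$ be the number of $i \in \{1,\dots,p-1\}$ with $|A_0| + |A_i| - 1 \geq p$, and let $s$ be the number of $i \in \{1,\dots,p-1\}$ with $A_i \neq \emptyset$ and $|A_0| + |A_i| - 1 < p$. If $\ell = 1$, then $s \neq 1$. -}

module Defs where

open import Data.Nat using (ℕ; zero; suc; _+_; _∸_; NonZero)
open import Data.Nat.DivMod using (_mod_)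
open import Data.Fin using (Fin; toℕ)
open import Data.Fin.Properties using () renaming (_≟_ to _≟F_)
open import Data.Bool using (Bool; true; false; _∧_; if_then_else_)
open import Data.List using (List; []; _∷_; allFin; concatMap; map)
open import Data.Product using (_×_; _,_; Σ; ∃)
open import Relation.Nullary.Decidable using (⌊_⌋)
open import Relation.Binary.PropositionalEquality using (_≡_)

zeroF : ∀ {p} .{{_ : NonZero p}} → Fin p
zeroF {p} = 0 mod p

_+F_ : ∀ {p} .{{_ : NonZero p}} → Fin p → Fin p → Fin p
_+F_ {p} a b = (toℕ a + toℕ b) mod p

negF : ∀ {p} .{{_ : NonZero p}} → Fin p → Fin p
negF {p} a = (p ∸ toℕ a) mod p

Zp² : ℕ → Set
Zp² p = Fin p × Fin p

zero² : ∀ {p} .{{_ : NonZero p}} → Zp² p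
zero² = zeroF , zeroF

_⊕_ : ∀ {p} .{{_ : NonZero p}} → Zp² p → Zp² p → Zp² p
(a , b) ⊕ (c , d) = (a +F c) , (b +F d)

neg² : ∀ {p} .{{_ : NonZero p}} → Zp² p → Zp² p
neg² (a , b) = negF a , negF b

allZp² : (p : ℕ) → List (Zp² p)
allZp² p = concatMap (λ a → map (λ b → (a , b)) (allFin p)) (allFin p)

count : ∀ {A : Set} → (A → Bool) → List A → ℕ
count P [] = 0
count P (x ∷ xs) = if P x then suc (count P xs) else count P xs

SubsetZp² : ℕ → Set
SubsetZp² p = Zp² p → Bool

card : ∀ {p} → SubsetZp² p → ℕ
card {p} S = count S (allZp² p)

IsSubgroup : ∀ {p} .{{_ : NonZero p}} → SubsetZp² p → Set
IsSubgroup H =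
  (H zero² ≡ true)
  × (∀ x y → H x ≡ true → H y ≡ true → H (x ⊕ y) ≡ true)
  × (∀ x → H x ≡ true → H (neg² x) ≡ true)

-- c : ℤ_p² → ℤ_p assigns to each element the index i of its coset H_i,
-- i.e. x ∈ H_{c x}.
IsCosetIndexing : ∀ {p} .{{_ : NonZero p}} → SubsetZp² p → (Zp² p → Fin p) → Set
IsCosetIndexing {p} H c =
  (∀ x y → (c x ≡ c y → ∃ λ h → (H h ≡ true) × (x ≡ y ⊕ h))
         × (∀ h → H h ≡ true → x ≡ y ⊕ h → c x ≡ c y))
  × (∀ (i : Fin p) → ∃ λ x → c x ≡ i)
  × (∀ x y → c (x ⊕ y) ≡ c x +F c y)
  × (∀ x → H x ≡ true → c x ≡ zeroF)
  × (∀ x → c x ≡ zeroF → H x ≡ true)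

part : ∀ {p} → SubsetZp² p → (Zp² p → Fin p) → Fin p → SubsetZp² p
part A c i x = A x ∧ ⌊ c x ≟F i ⌋

-- Every element of A lies in some A_i, so |A| ≤ Σ_i |A_i|.  Here |A_0| ≤ |H| = p, the
-- unique i ≥ 1 with |A_0| + |A_i| - 1 ≥ p contributes at most |A_0|, a nonempty A_i with
-- |A_0| + |A_i| - 1 < p contributes at most p - |A_0|, and every other A_i is empty.  If
-- s = 1 as well, this gives 2p + 1 ≤ |A_0| + |A_0| + (p - |A_0|) = |A_0| + p ≤ 2p.
module Submission where

open import Defs
open import Algebra.Properties.CommutativeSemigroup using (interchange)
open import Data.Bool using (Bool; true; false; T; not; _∧_; if_then_else_)
open import Data.Fin as Fin using (Fin; toℕ)
open import Data.Fin.Properties using () renaming (_≟_ to _≟F_)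
open import Data.List using (List; []; _∷_; map; tabulate; allFin)
open import Data.List.Membership.Propositional using (_∈_)
open import Data.List.Membership.Propositional.Properties using (∈-allFin; ∈-tabulate⁻)
open import Data.List.Properties using (map-cong)
open import Data.List.Relation.Unary.Any using (here; there)
open import Data.Nat using (ℕ; zero; suc; _+_; _*_; _∸_; _≤_; _<_; _≤ᵇ_; _<ᵇ_; _≡ᵇ_; NonZero; z≤n; s≤s; z<s)
open import Data.Nat.ListAction using (sum)
open import Data.Nat.Primality using (Prime)
open import Data.Nat.Properties
open import Data.Product using (_×_; _,_; Σ)
open import Data.Unit using (tt)
open import Function using (_∘_)
open import Relation.Binary.PropositionalEquality using (_≡_; _≢_; refl; sym; trans; cong; cong₂; subst)
open import Relation.Nullary using (yes; no; contradiction)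

module _ {X : Set} where

  count-∷ : (P : X → Bool) (x : X) (xs : List X) →
            count P (x ∷ xs) ≡ (if P x then 1 else 0) + count P xs
  count-∷ P x xs with P x
  ... | true  = refl
  ... | false = refl

  count-mono : (P Q : X → Bool) → (∀ x → P x ≡ true → Q x ≡ true) →
               ∀ xs → count P xs ≤ count Q xs
  count-mono P Q P⊆Q [] = z≤n
  count-mono P Q P⊆Q (x ∷ xs) with P x in Px
  ... | true rewrite P⊆Q x Px = s≤s (count-mono P Q P⊆Q xs)
  ... | false with Q x
  ...   | true  = m≤n⇒m≤1+n (count-mono P Q P⊆Q xs)
  ...   | false = count-mono P Q P⊆Q xs

  ∈⇒count-pos : (P : X → Bool) {x : X} {xs : List X} → x ∈ xs → P x ≡ true → 1 ≤ count P xs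
  ∈⇒count-pos P {xs = y ∷ ys} x∈ Px rewrite count-∷ P y ys with x∈
  ... | here refl rewrite Px = s≤s z≤n
  ... | there x∈ys = m≤n⇒m≤o+n _ (∈⇒count-pos P x∈ys Px)

  count*≡sum : (P : X → Bool) (a : ℕ) (xs : List X) →
               count P xs * a ≡ sum (map (λ x → if P x then a else 0) xs)
  count*≡sum P a [] = refl
  count*≡sum P a (x ∷ xs) with P x
  ... | true  = cong (a +_) (count*≡sum P a xs)
  ... | false = count*≡sum P a xs

  sum-map-+ : (f g : X → ℕ) (xs : List X) →
              sum (map (λ x → f x + g x) xs) ≡ sum (map f xs) + sum (map g xs)
  sum-map-+ f g [] = refl
  sum-map-+ f g (x ∷ xs) =
    trans (cong (f x + g x +_) (sum-map-+ f g xs)) (interchange +-commutativeSemigroup (f x) (g x) _ _)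

  sum-map-mono : (f g : X → ℕ) (xs : List X) → (∀ {x} → x ∈ xs → f x ≤ g x) →
                 sum (map f xs) ≤ sum (map g xs)
  sum-map-mono f g []       f≤g = z≤n
  sum-map-mono f g (x ∷ xs) f≤g = +-mono-≤ (f≤g (here refl)) (sum-map-mono f g xs (f≤g ∘ there))

  sum-map-≤-count* : (P Q : X → Bool) (f : X → ℕ) (a b : ℕ) (xs : List X) →
                     (∀ {x} → x ∈ xs → f x ≤ (if P x then a else 0) + (if Q x then b else 0)) →
                     sum (map f xs) ≤ count P xs * a + count Q xs * b
  sum-map-≤-count* P Q f a b xs f≤ = begin
    sum (map f xs)                                          ≤⟨ sum-map-mono f _ xs f≤ ⟩
    sum (map (λ x → (if P x then a else 0) + (if Q x then b else 0)) xs)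
                                                            ≡⟨ sum-map-+ _ _ xs ⟩
    sum (map (λ x → if P x then a else 0) xs) + sum (map (λ x → if Q x then b else 0) xs)
                                                            ≡⟨ cong₂ _+_ (count*≡sum P a xs) (count*≡sum Q b xs) ⟨
    count P xs * a + count Q xs * b                         ∎
    where open ≤-Reasoning

module _ {X I : Set} where

  count-≤-sum-count : (P : X → Bool) (Q : I → X → Bool) (is : List I) →
                      (∀ x → P x ≡ true → Σ I λ i → i ∈ is × Q i x ≡ true) →
                      ∀ xs → count P xs ≤ sum (map (λ i → count (Q i) xs) is)
  count-≤-sum-count P Q is covered [] = z≤n
  count-≤-sum-count P Q is covered (x ∷ xs) = begin
    count P (x ∷ xs)                                           ≡⟨ count-∷ P x xs ⟩
    (if P x then 1 else 0) + count P xs                        ≤⟨ +-mono-≤ head (count-≤-sum-count P Q is covered xs) ⟩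
    count (λ i → Q i x) is + sum (map (λ i → count (Q i) xs) is)
                                                               ≡⟨ cong (_+ _) (trans (sym (*-identityʳ _)) (count*≡sum (λ i → Q i x) 1 is)) ⟩
    sum (map (λ i → if Q i x then 1 else 0) is) + sum (map (λ i → count (Q i) xs) is)
                                                               ≡⟨ sum-map-+ _ _ is ⟨
    sum (map (λ i → (if Q i x then 1 else 0) + count (Q i) xs) is)
                                                               ≡⟨ cong sum (map-cong (λ i → count-∷ (Q i) x xs) is) ⟨
    sum (map (λ i → count (Q i) (x ∷ xs)) is)                  ∎
    where
    open ≤-Reasoning
    head : (if P x then 1 else 0) ≤ count (λ i → Q i x) is
    head with P x in Px
    ... | false = z≤n
    ... | true with covered x Px
    ...   | i , i∈is , Qix = ∈⇒count-pos (λ i → Q i x) i∈is Qix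

module _ {p : ℕ} (A : SubsetZp² p) (c : Zp² p → Fin p) where

  part-index : ∀ {i} x → part A c i x ≡ true → c x ≡ i
  part-index {i} x x∈Aᵢ with A x | c x ≟F i
  ... | _     | yes cx≡i = cx≡i
  part-index x () | true  | no _
  part-index x () | false | no _

  part-self : ∀ x → A x ≡ true → part A c (c x) x ≡ true
  part-self x x∈A with A x | c x ≟F c x
  ... | true  | yes _ = refl
  ... | true  | no cx≢cx = contradiction refl cx≢cx
  ... | false | _ = x∈A

  card≤sum-card-part : card A ≤ sum (map (λ i → card (part A c i)) (allFin p))
  card≤sum-card-part =
    count-≤-sum-count A (part A c) (allFin p) (λ x x∈A → c x , ∈-allFin (c x) , part-self x x∈A) (allZp² p)

  card-part-zero≤card : .{{_ : NonZero p}} → (H : SubsetZp² p) → IsCosetIndexing H c →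
                        card (part A c zeroF) ≤ card H
  card-part-zero≤card H (_ , _ , _ , _ , index0⇒H) =
    count-mono (part A c zeroF) H (λ x x∈A₀ → index0⇒H x (part-index x x∈A₀)) (allZp² p)

a+m∸1<p⇒m≤p∸a : ∀ a k p → a + suc k ∸ 1 < p → suc k ≤ p ∸ a
a+m∸1<p⇒m≤p∸a a k p a+k<p = m+n≤o⇒m≤o∸n (suc k) (subst (_≤ p) shift a+k<p)
  where
  shift : suc (a + suc k ∸ 1) ≡ suc k + a
  shift = trans (cong (λ t → suc (t ∸ 1)) (+-suc a k)) (cong suc (+-comm a k))

nonzero-part-bound : ∀ {a p} m → m ≤ a →
                     m ≤ (if p ≤ᵇ a + m ∸ 1 then a else 0) + (if (0 <ᵇ m) ∧ (a + m ∸ 1 <ᵇ p) then p ∸ a else 0)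
nonzero-part-bound {a} {p} m m≤a with p ≤ᵇ a + m ∸ 1 in large
... | true = m≤n⇒m≤n+o _ m≤a
... | false with m
...   | zero = z≤n
...   | suc k with a + suc k ∸ 1 <ᵇ p in small
...     | true  = a+m∸1<p⇒m≤p∸a a k p (<ᵇ⇒< _ p (subst T (sym small) tt))
...     | false = contradiction (≤⇒≤ᵇ {p} {a + suc k ∸ 1} (≮⇒≥ (subst T small ∘ <⇒<ᵇ))) (subst T large)

lemma3p9 : (p : ℕ) .{{_ : NonZero p}} → Prime p → 5 ≤ p
    → (A : SubsetZp² p) → card A ≡ 2 * p + 1
    → (H : SubsetZp² p) → IsSubgroup H → card H ≡ p
    → (c : Zp² p → Fin p) → IsCosetIndexing H c
    → (∀ i → card (part A c i) ≤ card (part A c zeroF))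
    → p + 3 ≤ 2 * card (part A c zeroF)
    → count (λ i → not (toℕ i ≡ᵇ 0) ∧ (p ≤ᵇ card (part A c zeroF) + card (part A c i) ∸ 1)) (allFin p) ≡ 1
    → count (λ i → not (toℕ i ≡ᵇ 0) ∧ (0 <ᵇ card (part A c i)) ∧ (card (part A c zeroF) + card (part A c i) ∸ 1 <ᵇ p)) (allFin p) ≢ 1
lemma3p9 (suc q) _ _ A |A|≡2p+1 H _ |H|≡p c indexing A₀-largest _ ℓ≡1 s≡1 = <-irrefl refl (begin-strict
  card A                                                      ≤⟨ card≤sum-card-part A c ⟩
  size Fin.zero + sum (map size (tabulate Fin.suc))           ≤⟨ +-mono-≤ (A₀-largest Fin.zero) nonzero-parts ⟩
  a + (count L (tabulate Fin.suc) * a + count S (tabulate Fin.suc) * (p ∸ a))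
                                                              ≡⟨ cong (a +_) (cong₂ (λ l s → l * a + s * (p ∸ a)) ℓ≡1 s≡1) ⟩
  a + (1 * a + 1 * (p ∸ a))                                   ≡⟨ cong (a +_) (cong₂ _+_ (*-identityˡ a) (*-identityˡ (p ∸ a))) ⟩
  a + (a + (p ∸ a))                                           ≡⟨ cong (a +_) (m+[n∸m]≡n a≤p) ⟩
  a + p                                                       ≤⟨ +-monoˡ-≤ p a≤p ⟩
  p + p                                                       ≡⟨ cong (p +_) (+-identityʳ p) ⟨
  2 * p                                                       <⟨ m<m+n (2 * p) z<s ⟩
  2 * p + 1                                                   ≡⟨ |A|≡2p+1 ⟨
  card A                                                      ∎)
  where
  open ≤-Reasoning
  p : ℕ
  p = suc q
  size : Fin p → ℕ
  size i = card (part A c i)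
  a : ℕ
  a = size zeroF
  -- L and S are false at index 0, so ℓ≡1 and s≡1 are definitionally counts over tabulate Fin.suc.
  L S : Fin p → Bool
  L i = not (toℕ i ≡ᵇ 0) ∧ (p ≤ᵇ a + size i ∸ 1)
  S i = not (toℕ i ≡ᵇ 0) ∧ (0 <ᵇ size i) ∧ (a + size i ∸ 1 <ᵇ p)
  a≤p : a ≤ p
  a≤p = subst (a ≤_) |H|≡p (card-part-zero≤card A c H indexing)
  nonzero-parts : sum (map size (tabulate Fin.suc)) ≤ count L (tabulate Fin.suc) * a + count S (tabulate Fin.suc) * (p ∸ a)
  nonzero-parts = sum-map-≤-count* L S size a (p ∸ a) (tabulate Fin.suc) bound
    where
    bound : ∀ {i} → i ∈ tabulate Fin.suc → size i ≤ (if L i then a else 0) + (if S i then p ∸ a else 0)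
    bound i∈ with ∈-tabulate⁻ i∈
    ... | j , refl = nonzero-part-bound (size (Fin.suc j)) (A₀-largest (Fin.suc j))
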